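{- A minion is finitely generated if and only if it is locally finite and has bounded essential arity.
   Context: Write $n=\{0,\dots,n-1\}$. A minion $\mathcal M$ consists of sets $\mathcal M_n$ ($n\ge1$) and for every map $\alpha:n\to k$ a map $\mathcal M_n\to\mathcal M_k$, $f\mapsto f\alpha$, with $f\,\mathrm{id}_n=f$ and $(f\alpha)\beta=f(\beta\circ\alpha)$. A subminion is a family of subsets closed under these maps. $\mathcal M$ is finitely generated if there is a finite set $S$ of elements (of various arities) such that the smallest subminion containing $S$, namely $\{s\alpha: s\in S\cap\mathcal M_k,\ \alpha:k\to n\}$ in arity $n$, equals $\mathcal M$. $\mathcal M$ is locally finite if each $\mathcal M_n$ is finite. For $f\in\mathcal M_n$, a coordinate $i\in n$ is inessential if $f\iota=f\gamma_i$, where $\iota:n\to n+1$ is the inclusion and $\gamma_i:n\to n+1$ sends $i\mapsto n$ and fixes all other elements; otherwise $i$ is essential. $\mathcal M$ has bounded essential arity if there is $N$ such that every element of $\mathcal M$ has at most $N$ essential coordinates. -}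

module Defs where

open import Data.Nat using (ℕ; suc; _≤_)
open import Data.Fin using (Fin; inject₁; fromℕ; _≟_)
open import Data.Product using (Σ; ∃; ∃-syntax; _×_)
open import Function using (id; _∘_; _↔_)
open import Function.Definitions using (Injective)
open import Relation.Binary.PropositionalEquality using (_≡_)
open import Relation.Nullary using (¬_; yes; no)

-- Convention: arities are positive.  We index by ℕ with a shift:
--   El n  is the set 𝓜_{n+1} of elements of arity n+1, whose coordinate set is Fin (suc n).
record Minion : Set₁ where
  field
    El   : ℕ → Set
    _·_  : ∀ {n k} → El n → (Fin (suc n) → Fin (suc k)) → El k
    ·-id : ∀ {n} (f : El n) → f · id ≡ f
    ·-∘  : ∀ {n k l} (f : El n) (α : Fin (suc n) → Fin (suc k))
             (β : Fin (suc k) → Fin (suc l)) → (f · α) · β ≡ f · (β ∘ α)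
    -- maps are functions: pointwise equal maps act equally
    -- (needed since Agda lacks function extensionality)
    ·-cong : ∀ {n k} (f : El n) (α β : Fin (suc n) → Fin (suc k)) →
             (∀ i → α i ≡ β i) → f · α ≡ f · β

module _ (𝓜 : Minion) where
  open Minion 𝓜

  IsFinite : Set → Set
  IsFinite A = ∃[ m ] (A ↔ Fin m)

  FinitelyGenerated : Set
  FinitelyGenerated =
    ∃[ r ] Σ (Fin r → ℕ) λ ar → Σ ((i : Fin r) → El (ar i)) λ gen →
      ∀ n (f : El n) → ∃[ i ] ∃[ α ] gen i · α ≡ f

  LocallyFinite : Set
  LocallyFinite = ∀ n → IsFinite (El n)

  ι : ∀ {n} → Fin (suc n) → Fin (suc (suc n))
  ι = inject₁

  γ : ∀ {n} → Fin (suc n) → Fin (suc n) → Fin (suc (suc n))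
  γ {n} i j with j ≟ i
  ... | yes _ = fromℕ (suc n)
  ... | no  _ = inject₁ j

  Inessential : ∀ {n} → El n → Fin (suc n) → Set
  Inessential f i = f · ι ≡ f · γ i

  Essential : ∀ {n} → El n → Fin (suc n) → Set
  Essential f i = ¬ Inessential f i

  AtMostEssential : ℕ → ∀ {n} → El n → Set
  AtMostEssential N {n} f =
    ∀ m (e : Fin m → Fin (suc n)) → Injective _≡_ _≡_ e →
      (∀ j → Essential f (e j)) → m ≤ N

  BoundedEssentialArity : Set
  BoundedEssentialArity = ∃[ N ] ∀ n (f : El n) → AtMostEssential N f

{-# OPTIONS --safe #-}
-- A minor g · α can only depend on the coordinates in the image of α, so if every element is a
-- minor of one of finitely many generators, the largest generator arity bounds the number of
-- essential coordinates, and each arity n contains only the finitely many minors g · α with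
-- α ranging over the maps into Fin (suc n).  Conversely, if an element has more coordinates
-- than the bound N on essential coordinates, one of its coordinates i is inessential, and then
-- it is the minor along punchIn i of an element of one smaller arity.  Iterating, every element
-- is a minor of one of the finitely many elements of arity at most N + 1.  Excluded middle is
-- only used to decide equality of elements.
module Submission where

open import Defs
open import Data.Product using (_×_)
open import Function using (_⇔_)
open import Level using (0ℓ)
open import Axiom.ExcludedMiddle using (ExcludedMiddle)

open import Axiom.UniquenessOfIdentityProofs using (module Decidable⇒UIP)
open import Data.Fin as Fin
  using (Fin; zero; suc; inject₁; fromℕ; punchIn; punchOut; finToFun; funToFin)
open import Data.Fin.Properties using (any?; injective⇒≤; punchIn-punchOut; finToFun-funToFin)
open import Data.List
  using (List; _∷_; map; concatMap; allFin; upTo; tabulate; length; lookup; deduplicate)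
open import Data.List.Membership.Propositional using (_∈_; lose)
open import Data.List.Membership.Propositional.Properties
  using (∈-map⁺; ∈-concatMap⁺; ∈-allFin; ∈-upTo⁺; ∈-lookup; ∈-deduplicate⁺)
open import Data.List.Membership.Setoid.Properties using (unique⇒irrelevant)
open import Data.List.Relation.Unary.All.Properties using (tabulate⁻)
open import Data.List.Relation.Unary.Any as Any using (Any)
open import Data.List.Relation.Unary.Any.Properties using (lookup-index)
open import Data.List.Relation.Unary.Unique.DecPropositional.Properties using (deduplicate-!)
open import Data.Nat using (ℕ; zero; suc; _≤_; _^_; s≤s; z≤n; _≤?_)
open import Data.Nat.Properties using (≤-totalOrder; ≤-trans; ≤⇒≯; ≰⇒>; <⇒≤)
open import Data.List.Extrema ≤-totalOrder using (max; xs≤max)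
open import Data.Product using (Σ; ∃; ∃-syntax; _,_; proj₁; proj₂)
open import Data.Vec.Functional using (insertAt)
open import Data.Vec.Functional.Properties using (insertAt-lookup; insertAt-punchIn)
open import Function using (id; _∘_; _↔_; mk⇔; Inverse; mk↔ₛ′)
open import Function.Definitions using (Injective)
open import Relation.Binary.Definitions using (DecidableEquality)
open import Relation.Binary.PropositionalEquality
open import Relation.Nullary using (yes; no; contradiction)

index-∈-lookup : ∀ {A : Set} (xs : List A) i → Any.index (∈-lookup {xs = xs} i) ≡ i
index-∈-lookup (x ∷ xs) zero    = refl
index-∈-lookup (x ∷ xs) (suc i) = cong suc (index-∈-lookup xs i)

enumerable⇒finite : ∀ {A : Set} → DecidableEquality A →
                    (xs : List A) → (∀ x → x ∈ xs) → ∃[ m ] (A ↔ Fin m)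
enumerable⇒finite {A} _≟_ xs enumerates =
  length ys , mk↔ₛ′ position (lookup ys) position-lookup lookup-position
  where
  ys : List A
  ys = deduplicate _≟_ xs

  position : A → Fin (length ys)
  position x = Any.index (∈-deduplicate⁺ _≟_ (enumerates x))

  position-lookup : ∀ i → position (lookup ys i) ≡ i
  position-lookup i = trans
    (cong Any.index (unique⇒irrelevant (setoid A) (Decidable⇒UIP.≡-irrelevant _≟_)
                       (deduplicate-! _≟_ xs) _ (∈-lookup i)))
    (index-∈-lookup ys i)

  lookup-position : ∀ x → lookup ys (position x) ≡ x
  lookup-position x = sym (lookup-index (∈-deduplicate⁺ _≟_ (enumerates x)))

injective-into-image⇒≤ : ∀ {m a b} (α : Fin a → Fin b) (e : Fin m → Fin b) →
                         Injective _≡_ _≡_ e → (∀ j → ∃ λ k → α k ≡ e j) → m ≤ a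
injective-into-image⇒≤ α e e-injective preimage =
  injective⇒≤ {f = proj₁ ∘ preimage} injective
  where
  injective : Injective _≡_ _≡_ (proj₁ ∘ preimage)
  injective {x} {y} eq = e-injective (begin
    e x                     ≡⟨ proj₂ (preimage x) ⟨
    α (proj₁ (preimage x))  ≡⟨ cong α eq ⟩
    α (proj₁ (preimage y))  ≡⟨ proj₂ (preimage y) ⟩
    e y                     ∎)
    where open ≡-Reasoning

punchIn-fromℕ : ∀ {n} (j : Fin n) → punchIn (fromℕ n) j ≡ inject₁ j
punchIn-fromℕ zero    = refl
punchIn-fromℕ (suc j) = cong suc (punchIn-fromℕ j)

-- The value zero at i is junk.
collapse : ∀ {n} → Fin (suc (suc n)) → Fin (suc (suc n)) → Fin (suc n)
collapse i j with i Fin.≟ j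
... | yes _   = zero
... | no i≢j  = punchOut i≢j

punchIn-collapse : ∀ {n} {i j : Fin (suc (suc n))} → j ≢ i → punchIn i (collapse i j) ≡ j
punchIn-collapse {i = i} {j} j≢i with i Fin.≟ j
... | yes i≡j = contradiction (sym i≡j) j≢i
... | no i≢j  = punchIn-punchOut i≢j

module _ (𝓜 : Minion) where
  open Minion 𝓜

  infix 4 _isMinorOf_
  _isMinorOf_ : ∀ {n a} → El n → El a → Set
  f isMinorOf g = ∃ λ α → g · α ≡ f

  isMinorOf-trans : ∀ {n a b} {f : El n} {g : El a} {h : El b} →
                    f isMinorOf g → g isMinorOf h → f isMinorOf h
  isMinorOf-trans {f = f} {g} {h} (α , gα≡f) (β , hβ≡g) = α ∘ β , (begin
    h · (α ∘ β)  ≡⟨ ·-∘ h β α ⟨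
    (h · β) · α  ≡⟨ cong (_· α) hβ≡g ⟩
    g · α        ≡⟨ gα≡f ⟩
    f            ∎)
    where open ≡-Reasoning

  γ-≢ : ∀ {n} {i j : Fin (suc n)} → j ≢ i → γ 𝓜 i j ≡ inject₁ j
  γ-≢ {i = i} {j} j≢i with j Fin.≟ i
  ... | yes j≡i = contradiction j≡i j≢i
  ... | no _    = refl

  -- θ restricts to α along ι and to β along γ i, so inessentiality of i turns f · α into f · β.
  inessential-cong : ∀ {n k} {f : El n} {i : Fin (suc n)} → Inessential 𝓜 f i →
                     (α β : Fin (suc n) → Fin (suc k)) → (∀ j → j ≢ i → α j ≡ β j) →
                     f · α ≡ f · β
  inessential-cong {n} {f = f} {i} inessential α β α≡β = begin
    f · α            ≡⟨ ·-cong f _ _ (sym ∘ θ-ι) ⟩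
    f · (θ ∘ ι 𝓜)     ≡⟨ ·-∘ f (ι 𝓜) θ ⟨
    (f · ι 𝓜) · θ     ≡⟨ cong (_· θ) inessential ⟩
    (f · γ 𝓜 i) · θ   ≡⟨ ·-∘ f (γ 𝓜 i) θ ⟩
    f · (θ ∘ γ 𝓜 i)   ≡⟨ ·-cong f _ _ θ-γ ⟩
    f · β            ∎
    where
    open ≡-Reasoning

    θ : Fin (suc (suc n)) → Fin (suc _)
    θ = insertAt α (fromℕ (suc n)) (β i)

    θ-ι : ∀ j → θ (inject₁ j) ≡ α j
    θ-ι j = trans (cong θ (sym (punchIn-fromℕ j)))
                  (insertAt-punchIn α (fromℕ (suc n)) (β i) j)

    θ-γ : ∀ j → θ (γ 𝓜 i j) ≡ β j
    θ-γ j with j Fin.≟ i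
    ... | yes refl = insertAt-lookup α (fromℕ (suc n)) (β i)
    ... | no j≢i   = trans (θ-ι j) (α≡β j j≢i)

  inessential⇒isMinorOf-collapse : ∀ {n} {f : El (suc n)} {i} → Inessential 𝓜 f i →
                                   f isMinorOf (f · collapse i)
  inessential⇒isMinorOf-collapse {f = f} {i} inessential = punchIn i , (begin
    (f · collapse i) · punchIn i  ≡⟨ ·-∘ f (collapse i) (punchIn i) ⟩
    f · (punchIn i ∘ collapse i)  ≡⟨ inessential-cong inessential _ id (λ _ → punchIn-collapse) ⟩
    f · id                        ≡⟨ ·-id f ⟩
    f                             ∎)
    where open ≡-Reasoning

  inessential-outside-image : ∀ {a n} (g : El a) (α : Fin (suc a) → Fin (suc n)) {j} →
                              (∀ k → α k ≢ j) → Inessential 𝓜 (g · α) j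
  inessential-outside-image g α {j} j∉image = begin
    (g · α) · ι 𝓜    ≡⟨ ·-∘ g α (ι 𝓜) ⟩
    g · (ι 𝓜 ∘ α)    ≡⟨ ·-cong g _ _ (λ k → sym (γ-≢ (j∉image k))) ⟩
    g · (γ 𝓜 j ∘ α)  ≡⟨ ·-∘ g α (γ 𝓜 j) ⟨
    (g · α) · γ 𝓜 j  ∎
    where open ≡-Reasoning

  essential⇒∈image : ∀ {a n} (g : El a) (α : Fin (suc a) → Fin (suc n)) {j} →
                     Essential 𝓜 (g · α) j → ∃ λ k → α k ≡ j
  essential⇒∈image g α {j} essential with any? (λ k → α k Fin.≟ j)
  ... | yes j∈image = j∈image
  ... | no  j∉image =
    contradiction (inessential-outside-image g α (λ k αk≡j → j∉image (k , αk≡j)))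
                  essential

  isMinorOf⇒atMostEssential : ∀ {n a} {f : El n} {g : El a} →
                              f isMinorOf g → AtMostEssential 𝓜 (suc a) f
  isMinorOf⇒atMostEssential {g = g} (α , refl) m e e-injective e-essential =
    injective-into-image⇒≤ α e e-injective (λ j → essential⇒∈image g α (e-essential j))

  minors : ∀ {a} → El a → (n : ℕ) → List (El n)
  minors {a} g n = map (λ c → g · finToFun c) (allFin (suc n ^ suc a))

  ∈-minors : ∀ {a n} (g : El a) (α : Fin (suc a) → Fin (suc n)) → g · α ∈ minors g n
  ∈-minors g α = subst (_∈ minors g _) (·-cong g _ _ (finToFun-funToFin α))
                       (∈-map⁺ (λ c → g · finToFun c) (∈-allFin (funToFin α)))

  finitelyGenerated⇒locallyFinite : (∀ {n} → DecidableEquality (El n)) →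
                                    FinitelyGenerated 𝓜 → LocallyFinite 𝓜
  finitelyGenerated⇒locallyFinite _≟_ (r , ar , gen , generated) n =
    enumerable⇒finite _≟_ (concatMap (λ i → minors (gen i) n) (allFin r)) enumerates
    where
    enumerates : ∀ f → f ∈ concatMap (λ i → minors (gen i) n) (allFin r)
    enumerates f with i , α , genα≡f ← generated n f =
      ∈-concatMap⁺ (λ i → minors (gen i) n)
        (lose (∈-allFin i) (subst (_∈ minors (gen i) n) genα≡f (∈-minors (gen i) α)))

  finitelyGenerated⇒boundedEssentialArity : FinitelyGenerated 𝓜 → BoundedEssentialArity 𝓜
  finitelyGenerated⇒boundedEssentialArity (r , ar , gen , generated) = max 0 arities , bounded
    where
    arities : List ℕ
    arities = tabulate (suc ∘ ar)

    bounded : ∀ n (f : El n) → AtMostEssential 𝓜 (max 0 arities) f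
    bounded n f m e e-injective e-essential with i , f-minor ← generated n f =
      ≤-trans (isMinorOf⇒atMostEssential f-minor m e e-injective e-essential)
              (tabulate⁻ (xs≤max 0 arities) i)

  Generates : List (Σ ℕ El) → Set
  Generates gs = ∀ n (f : El n) → Any (λ g → f isMinorOf proj₂ g) gs

  generates⇒finitelyGenerated : ∀ gs → Generates gs → FinitelyGenerated 𝓜
  generates⇒finitelyGenerated gs generates =
    length gs , proj₁ ∘ lookup gs , proj₂ ∘ lookup gs ,
    λ n f → Any.index (generates n f) , lookup-index (generates n f)

  module _ (finite : LocallyFinite 𝓜) where

    elementsOfArity : ∀ n → List (El n)
    elementsOfArity n = map (Inverse.from (proj₂ (finite n))) (allFin _)

    ∈-elementsOfArity : ∀ {n} (f : El n) → f ∈ elementsOfArity n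
    ∈-elementsOfArity {n} f = subst (_∈ elementsOfArity n)
      (Inverse.strictlyInverseʳ (proj₂ (finite n)) f)
      (∈-map⁺ (Inverse.from (proj₂ (finite n))) (∈-allFin _))

    elementsOfArity≤ : ℕ → List (Σ ℕ El)
    elementsOfArity≤ N = concatMap (λ m → map (m ,_) (elementsOfArity m)) (upTo (suc N))

    ∈-elementsOfArity≤ : ∀ {m N} → m ≤ N → (g : El m) → (m , g) ∈ elementsOfArity≤ N
    ∈-elementsOfArity≤ {m} m≤N g =
      ∈-concatMap⁺ (λ m → map (m ,_) (elementsOfArity m))
        (lose (∈-upTo⁺ (s≤s m≤N)) (∈-map⁺ (m ,_) (∈-elementsOfArity g)))

  module _ (_≟_ : ∀ {n} → DecidableEquality (El n)) where

    someInessential : ∀ {N n} {f : El n} → AtMostEssential 𝓜 N f → N ≤ n →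
                      ∃ (Inessential 𝓜 f)
    someInessential {N} {n} {f} bounded N≤n
      with any? (λ i → (f · ι 𝓜) ≟ (f · γ 𝓜 i))
    ... | yes found = found
    ... | no  none  =
      contradiction (bounded (suc n) id (λ eq → eq) (λ i inessential → none (i , inessential)))
                    (≤⇒≯ N≤n)

    isMinorOfArity≤ : ∀ {N} → (∀ n (f : El n) → AtMostEssential 𝓜 N f) →
                      ∀ n (f : El n) → ∃[ m ] m ≤ N × Σ (El m) (f isMinorOf_)
    isMinorOfArity≤ {N} bounded n f with n ≤? N
    ... | yes n≤N = n , n≤N , f , id , ·-id f
    isMinorOfArity≤ bounded zero    f | no 0≰N = contradiction z≤n 0≰N
    isMinorOfArity≤ bounded (suc n) f | no n≰N
      with i , inessential ← someInessential (bounded (suc n) f) (<⇒≤ (≰⇒> n≰N))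
      with m , m≤N , g , collapsed-minor ← isMinorOfArity≤ bounded n (f · collapse i) =
      m , m≤N , g , isMinorOf-trans (inessential⇒isMinorOf-collapse inessential) collapsed-minor

    locallyFinite⇒boundedEssentialArity⇒finitelyGenerated :
      LocallyFinite 𝓜 → BoundedEssentialArity 𝓜 → FinitelyGenerated 𝓜
    locallyFinite⇒boundedEssentialArity⇒finitelyGenerated finite (N , bounded) =
      generates⇒finitelyGenerated (elementsOfArity≤ finite N) generates
      where
      generates : Generates (elementsOfArity≤ finite N)
      generates n f with m , m≤N , g , f-minor ← isMinorOfArity≤ bounded n f =
        lose {P = λ g → f isMinorOf proj₂ g} (∈-elementsOfArity≤ finite m≤N g) f-minor

proposition2p6p11 : ExcludedMiddle 0ℓ → (𝓜 : Minion) →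
    FinitelyGenerated 𝓜 ⇔ (LocallyFinite 𝓜 × BoundedEssentialArity 𝓜)
proposition2p6p11 em 𝓜 = mk⇔
  (λ fg → finitelyGenerated⇒locallyFinite 𝓜 _≟_ fg ,
          finitelyGenerated⇒boundedEssentialArity 𝓜 fg)
  (λ (finite , bounded) →
     locallyFinite⇒boundedEssentialArity⇒finitelyGenerated 𝓜 _≟_ finite bounded)
  where
  _≟_ : ∀ {n} → DecidableEquality (Minion.El 𝓜 n)
  _ ≟ _ = em
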